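{- Let $N$ be a network and $F$ the undirected graph formed by the undirected edges of $N$ (on the node set of $N$). Then $F$ is a forest such that: (1) each tree of $F$ corresponds to an undirected component of $N$, and has at most one node $v$ with $\deg_i(v,N)\ge1$; (2) the root components of $N$ are exactly the trees of $F$ without such nodes, and they contain tree nodes only.
   Context: A semidirected graph is $N=(V,E)$ with $E=E_U\sqcup E_D$, $E_U$ undirected edges $uv$, $E_D$ directed edges $(u,v)$ ($u$ parent, $v$ child); parallel directed edges allowed, no self-loops. $\deg_i(v,N)$ is the number of directed edges with child $v$. $N'$ is compatible with $N$ if obtained by directing some undirected edges. A semidirected cycle is a semidirected graph whose undirected edges can be directed to make it a directed cycle; acyclic (SDAG) means containing no semidirected cycle; DAG = acyclic directed graph. Tree node: $\deg_i\le1$; hybrid node otherwise. Hybrid edge: directed edge with hybrid child; $E_H(N)$ their set. SDAG $N'$ is phylogenetically compatible with SDAG $N$ if compatible and $E_H(N')=E_H(N)$; a rooted partner is a DAG phylogenetically compatible with $N$; a network is an SDAG admitting a rooted partner. A semidirected path from $u_0$ to $u_n$ is $u_0\dots u_n$ with $u_{i-1}u_i$ or $(u_{i-1},u_i)$ an edge for each $i$; $v\lesssim u$ if there is a semidirected path from $u$ to $v$; $u\sim v$ if $u\lesssim v$ and $v\lesssim u$; $\lesssim$ is a partial order on $\sim$-classes. An undirected component is the subgraph induced by a $\sim$-class; a root component is an undirected component whose class is maximal under $\lesssim$. -}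

module Defs where

open import Data.Nat using (ℕ; zero; suc; _+_; _≤_)
open import Data.Nat.DivMod using (_mod_)
open import Data.Fin using (Fin; toℕ; splitAt)
open import Data.Fin.Properties using (_≟_)
open import Data.Bool using (Bool; true; false)
open import Data.List using (length; filter)
open import Data.List.Base using (allFin)
open import Data.Product using (Σ; _×_; _,_; proj₁; proj₂; ∃)
open import Data.Sum using (_⊎_; inj₁; inj₂; [_,_]′)
open import Relation.Nullary using (¬_)
open import Relation.Binary.PropositionalEquality using (_≡_; _≢_)
open import Function using (_∘_; _⇔_)
open import Function.Definitions using (Injective)

-- Undirected edges are indexed by Fin mU; U i = (a , b) denotes the
-- undirected edge ab.  Directed edges are indexed by Fin mD;
-- D j = (parent , child).  Parallel directed edges are allowed
-- (D need not be injective); undirected edges form a set (no two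
-- indices denote the same unordered pair); no self-loops.

record SDGraph : Set where
  field
    n  : ℕ
    mU : ℕ
    mD : ℕ
    U  : Fin mU → Fin n × Fin n
    D  : Fin mD → Fin n × Fin n
    U-noloop : ∀ i → proj₁ (U i) ≢ proj₂ (U i)
    D-noloop : ∀ j → proj₁ (D j) ≢ proj₂ (D j)
    U-set    : ∀ i i' → (U i ≡ U i' ⊎ U i ≡ (proj₂ (U i') , proj₁ (U i'))) → i ≡ i'

open SDGraph public

Node : SDGraph → Set
Node N = Fin (n N)

Joins : (N : SDGraph) → Fin (mU N) → Node N → Node N → Set
Joins N i a b = U N i ≡ (a , b) ⊎ U N i ≡ (b , a)

indeg : (N : SDGraph) → Node N → ℕ
indeg N v = length (filter (λ j → proj₂ (D N j) ≟ v) (allFin (mD N)))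

TreeNode : (N : SDGraph) → Node N → Set
TreeNode N v = indeg N v ≤ 1

HybridNode : (N : SDGraph) → Node N → Set
HybridNode N v = 2 ≤ indeg N v

HybridEdge : (N : SDGraph) → Fin (mD N) → Set
HybridEdge N j = HybridNode N (proj₂ (D N j))

Edge : SDGraph → Set
Edge N = Fin (mU N) ⊎ Fin (mD N)

SDStep : (N : SDGraph) → Edge N → Node N → Node N → Set
SDStep N (inj₁ i) a b = Joins N i a b
SDStep N (inj₂ j) a b = D N j ≡ (a , b)

next : ∀ {k} → Fin (suc k) → Fin (suc k)
next {k} i = suc (toℕ i) mod (suc k)

-- A semidirected cycle contained in N: distinct nodes v_0 … v_{k+1}
-- (at least two) and distinct edges e_0 … e_{k+1}, where e_i is either
-- an undirected edge v_i v_{i+1} or a directed edge (v_i , v_{i+1})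
-- (indices mod k+2); i.e. a subgraph whose undirected edges can be
-- directed to form a directed cycle.
record SDCycle (N : SDGraph) : Set where
  field
    k     : ℕ
    nodes : Fin (suc (suc k)) → Node N
    edges : Fin (suc (suc k)) → Edge N
    nodes-inj : Injective _≡_ _≡_ nodes
    edges-inj : Injective _≡_ _≡_ edges
    steps : ∀ i → SDStep N (edges i) (nodes i) (nodes (next i))

Acyclic : SDGraph → Set
Acyclic N = ¬ SDCycle N

Directed : SDGraph → Set
Directed N = mU N ≡ 0

-- A DAG compatible with N is obtained by directing
-- every undirected edge of N: an orientation o picks, for each
-- undirected edge U i = (a , b), the direction (a , b) (true) or (b , a)
-- (false).  Edges of the resulting graph are indexed by Fin (mU + mD),
-- the first mU being the formerly undirected edges, the rest the
-- directed edges of N (identified via splitAt).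

orient : (N : SDGraph) → (Fin (mU N) → Bool) → Fin (mU N) → Node N × Node N
orient N o i with o i
... | true  = U N i
... | false = proj₂ (U N i) , proj₁ (U N i)

fullyDirect : (N : SDGraph) → (Fin (mU N) → Bool) → SDGraph
fullyDirect N o = record
  { n  = n N
  ; mU = 0
  ; mD = mU N + mD N
  ; U  = λ ()
  ; D  = [ orient N o , D N ]′ ∘ splitAt (mU N)
  ; U-noloop = λ ()
  ; D-noloop = noloop
  ; U-set = λ ()
  }
  where
  noloop : ∀ e → proj₁ ([ orient N o , D N ]′ (splitAt (mU N) e))
                ≢ proj₂ ([ orient N o , D N ]′ (splitAt (mU N) e))
  noloop e with splitAt (mU N) e
  ... | inj₂ j = D-noloop N j
  ... | inj₁ i with o i
  ...   | true  = U-noloop N i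
  ...   | false = λ eq → U-noloop N i (Relation.Binary.PropositionalEquality.sym eq)

SameHybridEdges : (N : SDGraph) → (o : Fin (mU N) → Bool) → Set
SameHybridEdges N o =
  ∀ e → HybridEdge (fullyDirect N o) e
        ⇔ (Σ (Fin (mD N)) λ j → splitAt (mU N) e ≡ inj₂ j × HybridEdge N j)

RootedPartner : (N : SDGraph) → (Fin (mU N) → Bool) → Set
RootedPartner N o = Acyclic (fullyDirect N o) × SameHybridEdges N o

Network : SDGraph → Set
Network N = Acyclic N × ∃ (RootedPartner N)

data SDPath (N : SDGraph) : Node N → Node N → Set where
  []   : ∀ {u} → SDPath N u u
  _∷_  : ∀ {u w v} → (Σ (Edge N) λ e → SDStep N e u w) → SDPath N w v → SDPath N u v

Below : (N : SDGraph) → Node N → Node N → Set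
Below N v u = SDPath N u v

Equiv : (N : SDGraph) → Node N → Node N → Set
Equiv N u v = Below N u v × Below N v u

-- u lies in a root component: its ∼-class is maximal w.r.t. ≲
InRootComponent : (N : SDGraph) → Node N → Set
InRootComponent N u = ∀ w → Below N u w → Below N w u

data UPath (N : SDGraph) : Node N → Node N → Set where
  []  : ∀ {u} → UPath N u u
  _∷_ : ∀ {u w v} → (Σ (Fin (mU N)) λ i → Joins N i u w) → UPath N w v → UPath N u v

ConnectedF : (N : SDGraph) → Node N → Node N → Set
ConnectedF N u v = UPath N u v

record FCycle (N : SDGraph) : Set where
  field
    k     : ℕ
    nodes : Fin (suc (suc k)) → Node N
    edges : Fin (suc (suc k)) → Fin (mU N)
    nodes-inj : Injective _≡_ _≡_ nodes
    edges-inj : Injective _≡_ _≡_ edges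
    steps : ∀ i → Joins N (edges i) (nodes i) (nodes (next i))

ForestF : SDGraph → Set
ForestF N = ¬ FCycle N

-- An undirected path of N can be followed in both directions, so undirected
-- components lie inside ∼-classes.  Conversely, a directed edge (a , b) on a
-- semidirected path that returns to its start closes, after loop erasure, a
-- semidirected cycle; hence in an SDAG a ∼-class contains no directed edge,
-- ∼-classes are exactly the trees of F, and F has no cycle at all.
-- The rooted partner is used only through its hybrid edges: an undirected edge
-- oriented towards w is not a hybrid edge, so w has in-degree 1 in the partner.
-- Thus w has no incoming directed edge in N and no second undirected edge
-- oriented towards it.  Walking along an undirected path towards a node with
-- an incoming directed edge, every edge is therefore oriented backwards, which
-- leaves no room for a second such node in the same tree.

module Submission where

open import Defs
open import Data.Nat using (ℕ; zero; suc; _+_; _≤_; _≥_; _%_; z≤n; s≤s)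
open import Data.Nat.Properties using (≤-trans; n≤1+n; m≢1+n+m; ≰⇒>; n<1⇒n≡0; <⇒≢)
open import Data.Nat.DivMod using (n%n≡0; m<n⇒m%n≡m)
open import Data.Fin using (Fin; zero; suc; toℕ; fromℕ; inject₁; _↑ˡ_; _↑ʳ_; splitAt)
open import Data.Fin.Properties
  using (_≟_; any?; toℕ-injective; toℕ-fromℕ<; toℕ-fromℕ; toℕ-inject₁; toℕ<n;
         inject₁-injective; fromℕ≢inject₁; splitAt-↑ˡ; splitAt-↑ʳ; ↑ˡ-injective)
open import Data.Fin.Relation.Unary.Top using (view; ‵fromℕ; ‵inject₁)
open import Data.Bool using (Bool; true; false)
open import Data.List as List using (List; _∷_; filter; allFin)
open import Data.List.Relation.Unary.Any using (here; there)
open import Data.List.Membership.Propositional using (_∈_)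
open import Data.List.Membership.Propositional.Properties
  using (∈-length; ∈-filter⁺; ∈-filter⁻; ∈-allFin)
open import Data.Product using (Σ; ∃; _×_; _,_; proj₁; proj₂)
open import Data.Product.Properties using (,-injectiveˡ; ,-injectiveʳ)
open import Data.Sum using (_⊎_; inj₁; inj₂; [_,_]′)
open import Data.Sum.Properties using (inj₁-injective)
open import Data.Empty using (⊥-elim)
open import Data.Unit using (⊤)
open import Relation.Nullary using (¬_; yes; no)
open import Relation.Unary using (Decidable)
open import Relation.Binary.PropositionalEquality
open import Function using (_∘_; _⇔_; mk⇔; Equivalence)
open import Function.Definitions using (Injective)

∈-∈-≢⇒2≤length : ∀ {A : Set} {x y : A} {xs : List A} →
                 x ∈ xs → y ∈ xs → x ≢ y → 2 ≤ List.length xs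
∈-∈-≢⇒2≤length (here refl) (here refl) x≢y = ⊥-elim (x≢y refl)
∈-∈-≢⇒2≤length (here _)    (there y∈) _   = s≤s (∈-length y∈)
∈-∈-≢⇒2≤length (there x∈)  (here _)   _   = s≤s (∈-length x∈)
∈-∈-≢⇒2≤length (there x∈)  (there y∈) x≢y =
  ≤-trans (∈-∈-≢⇒2≤length x∈ y∈ x≢y) (n≤1+n _)

next-inject₁ : ∀ {k} (i : Fin (suc k)) → next (inject₁ i) ≡ suc i
next-inject₁ {k} i = toℕ-injective (begin
  toℕ (next (inject₁ i))              ≡⟨ toℕ-fromℕ< _ ⟩
  suc (toℕ (inject₁ i)) % suc (suc k) ≡⟨ cong (λ m → suc m % suc (suc k)) (toℕ-inject₁ i) ⟩
  suc (toℕ i) % suc (suc k)           ≡⟨ m<n⇒m%n≡m (s≤s (toℕ<n i)) ⟩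
  suc (toℕ i)                         ∎)
  where open ≡-Reasoning

next-fromℕ : ∀ k → next (fromℕ k) ≡ zero
next-fromℕ k = toℕ-injective (begin
  toℕ (next (fromℕ k))        ≡⟨ toℕ-fromℕ< _ ⟩
  suc (toℕ (fromℕ k)) % suc k ≡⟨ cong (λ m → suc m % suc k) (toℕ-fromℕ k) ⟩
  suc k % suc k               ≡⟨ n%n≡0 (suc k) ⟩
  0                           ∎)
  where open ≡-Reasoning

module _ (N : SDGraph) where

  incoming? : ∀ v → Decidable (λ j → proj₂ (D N j) ≡ v)
  incoming? v j = proj₂ (D N j) ≟ v

  private
    incoming∈ : ∀ {j v} → proj₂ (D N j) ≡ v → j ∈ filter (incoming? v) (allFin (mD N))
    incoming∈ {j} {v} j↦v = ∈-filter⁺ (incoming? v) {xs = allFin (mD N)} (∈-allFin j) j↦v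

  indeg>0⇒incoming : ∀ {v} → 1 ≤ indeg N v → ∃ λ j → proj₂ (D N j) ≡ v
  indeg>0⇒incoming {v} pos with filter (incoming? v) (allFin (mD N)) in eq | pos
  ... | j ∷ _ | _ =
    j , proj₂ (∈-filter⁻ (incoming? v) {xs = allFin (mD N)} (subst (j ∈_) (sym eq) (here refl)))

  incoming⇒indeg>0 : ∀ {j v} → proj₂ (D N j) ≡ v → 1 ≤ indeg N v
  incoming⇒indeg>0 = ∈-length ∘ incoming∈

  two-incoming⇒hybrid : ∀ {j j' v} → j ≢ j' →
                        proj₂ (D N j) ≡ v → proj₂ (D N j') ≡ v → HybridNode N v
  two-incoming⇒hybrid j≢j' j↦v j'↦v = ∈-∈-≢⇒2≤length (incoming∈ j↦v) (incoming∈ j'↦v) j≢j'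

  _++_ : ∀ {u w v} → SDPath N u w → SDPath N w v → SDPath N u v
  []      ++ q = q
  (s ∷ p) ++ q = s ∷ (p ++ q)

  Joins-sym : ∀ {i x y} → Joins N i x y → Joins N i y x
  Joins-sym (inj₁ e) = inj₂ e
  Joins-sym (inj₂ e) = inj₁ e

  UPath⇒SDPath : ∀ {u v} → UPath N u v → SDPath N u v
  UPath⇒SDPath []            = []
  UPath⇒SDPath ((i , J) ∷ p) = (inj₁ i , J) ∷ UPath⇒SDPath p

  UPath-reverse : ∀ {u v} → UPath N u v → UPath N v u
  UPath-reverse p = go p []
    where
    go : ∀ {x u v} → UPath N x v → UPath N x u → UPath N v u
    go []            acc = acc
    go ((i , J) ∷ p) acc = go p ((i , Joins-sym J) ∷ acc)

  length : ∀ {u v} → SDPath N u v → ℕ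
  length []      = 0
  length (_ ∷ p) = suc (length p)

  node : ∀ {u v} (p : SDPath N u v) → Fin (suc (length p)) → Node N
  node {u} _ zero      = u
  node (_ ∷ p) (suc i) = node p i

  edge : ∀ {u v} (p : SDPath N u v) → Fin (length p) → Edge N
  edge (s ∷ _) zero    = proj₁ s
  edge (_ ∷ p) (suc i) = edge p i

  step : ∀ {u v} (p : SDPath N u v) (i : Fin (length p)) →
         SDStep N (edge p i) (node p (inject₁ i)) (node p (suc i))
  step (s ∷ _) zero    = proj₂ s
  step (_ ∷ p) (suc i) = step p i

  node-last : ∀ {u v} (p : SDPath N u v) → node p (fromℕ (length p)) ≡ v
  node-last []      = refl
  node-last (_ ∷ p) = node-last p

  Simple : ∀ {u v} → SDPath N u v → Set
  Simple []          = ⊤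
  Simple {u} (_ ∷ p) = (∀ i → node p i ≢ u) × Simple p

  node-injective : ∀ {u v} (p : SDPath N u v) → Simple p → Injective _≡_ _≡_ (node p)
  node-injective []      _            {zero}  {zero}  _  = refl
  node-injective (_ ∷ p) _            {zero}  {zero}  _  = refl
  node-injective (_ ∷ p) (u∉p , _)    {zero}  {suc j} eq = ⊥-elim (u∉p j (sym eq))
  node-injective (_ ∷ p) (u∉p , _)    {suc i} {zero}  eq = ⊥-elim (u∉p i eq)
  node-injective (_ ∷ p) (_ , simple) {suc i} {suc j} eq =
    cong suc (node-injective p simple eq)

  suffix : ∀ {u v} (p : SDPath N u v) (i : Fin (suc (length p))) → SDPath N (node p i) v
  suffix p       zero    = p
  suffix (_ ∷ p) (suc i) = suffix p i

  suffix-simple : ∀ {u v} (p : SDPath N u v) i → Simple p → Simple (suffix p i)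
  suffix-simple p       zero    simple       = simple
  suffix-simple (_ ∷ p) (suc i) (_ , simple) = suffix-simple p i simple

  loop-erase : ∀ {u v} → SDPath N u v → Σ (SDPath N u v) Simple
  loop-erase []                = [] , _
  loop-erase {u} {v} (s ∷ p) with loop-erase p
  ... | q , simple with any? (λ i → node q i ≟ u)
  ...   | yes (i , qᵢ≡u) = subst (λ x → Σ (SDPath N x v) Simple) qᵢ≡u
                                 (suffix q i , suffix-simple q i simple)
  ...   | no  u∉q        = s ∷ q , (λ i qᵢ≡u → u∉q (i , qᵢ≡u)) , simple

  SDStep-same-or-reversed : ∀ {e x y x' y'} → SDStep N e x y → SDStep N e x' y' →
                            x ≡ x' ⊎ (x ≡ y' × y ≡ x')
  SDStep-same-or-reversed {inj₂ _} s        s'        = inj₁ (,-injectiveˡ (trans (sym s) s'))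
  SDStep-same-or-reversed {inj₁ _} (inj₁ s) (inj₁ s') = inj₁ (,-injectiveˡ (trans (sym s) s'))
  SDStep-same-or-reversed {inj₁ _} (inj₂ s) (inj₂ s') = inj₁ (,-injectiveʳ (trans (sym s) s'))
  SDStep-same-or-reversed {inj₁ _} (inj₁ s) (inj₂ s') =
    inj₂ (,-injectiveˡ (trans (sym s) s') , ,-injectiveʳ (trans (sym s) s'))
  SDStep-same-or-reversed {inj₁ _} (inj₂ s) (inj₁ s') =
    inj₂ (,-injectiveʳ (trans (sym s) s') , ,-injectiveˡ (trans (sym s) s'))

  edge-injective : ∀ {u v} (p : SDPath N u v) → Simple p → Injective _≡_ _≡_ (edge p)
  edge-injective p simple {i} {j} eᵢ≡eⱼ
    with SDStep-same-or-reversed (step p i)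
           (subst (λ e → SDStep N e (node p (inject₁ j)) (node p (suc j))) (sym eᵢ≡eⱼ) (step p j))
  ... | inj₁ same = inject₁-injective (node-injective p simple same)
  ... | inj₂ (back , forth) = ⊥-elim (m≢1+n+m (toℕ j) (begin
    toℕ j                 ≡⟨ toℕ-inject₁ j ⟨
    toℕ (inject₁ j)       ≡⟨ cong toℕ (node-injective p simple forth) ⟨
    suc (toℕ i)           ≡⟨ cong suc (toℕ-inject₁ i) ⟨
    suc (toℕ (inject₁ i)) ≡⟨ cong (suc ∘ toℕ) (node-injective p simple back) ⟩
    suc (suc (toℕ j))     ∎))
    where open ≡-Reasoning

  closing-edge-not-on-path : ∀ {a b j} → D N j ≡ (a , b) →
                             (p : SDPath N b a) → Simple p → ∀ i → edge p i ≢ inj₂ j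
  closing-edge-not-on-path {a} {j = j} a↦b p simple i eᵢ≡j =
    fromℕ≢inject₁ {i = i} (node-injective p simple (begin
      node p (fromℕ (length p)) ≡⟨ node-last p ⟩
      a                         ≡⟨ ,-injectiveˡ (trans (sym a↦b) j-traversed) ⟩
      node p (inject₁ i)        ∎))
    where
    open ≡-Reasoning
    j-traversed : D N j ≡ (node p (inject₁ i) , node p (suc i))
    j-traversed =
      subst (λ e → SDStep N e (node p (inject₁ i)) (node p (suc i))) eᵢ≡j (step p i)

  SDCycle-from-steps :
    ∀ {k} (nodes : Fin (suc (suc k)) → Node N) (edges : Fin (suc (suc k)) → Edge N) →
    Injective _≡_ _≡_ nodes → Injective _≡_ _≡_ edges →
    (∀ i → SDStep N (edges (inject₁ i)) (nodes (inject₁ i)) (nodes (suc i))) →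
    SDStep N (edges (fromℕ _)) (nodes (fromℕ _)) (nodes zero) →
    SDCycle N
  SDCycle-from-steps {k} nodes edges nodes-inj edges-inj inner last = record
    { k = k ; nodes = nodes ; edges = edges
    ; nodes-inj = nodes-inj ; edges-inj = edges-inj
    ; steps = steps }
    where
    steps : ∀ i → SDStep N (edges i) (nodes i) (nodes (next i))
    steps i with view i
    ... | ‵fromℕ     = subst (SDStep N (edges (fromℕ _)) (nodes (fromℕ _)) ∘ nodes)
                             (sym (next-fromℕ (suc k))) last
    ... | ‵inject₁ i = subst (SDStep N (edges (inject₁ i)) (nodes (inject₁ i)) ∘ nodes)
                             (sym (next-inject₁ i)) (inner i)

  edges-then : ∀ {u v} (p : SDPath N u v) → Edge N → Fin (suc (length p)) → Edge N
  edges-then []      e zero    = e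
  edges-then (s ∷ _) e zero    = proj₁ s
  edges-then (_ ∷ p) e (suc i) = edges-then p e i

  edges-then-inject₁ : ∀ {u v} (p : SDPath N u v) e i → edges-then p e (inject₁ i) ≡ edge p i
  edges-then-inject₁ (_ ∷ _) e zero    = refl
  edges-then-inject₁ (_ ∷ p) e (suc i) = edges-then-inject₁ p e i

  edges-then-fromℕ : ∀ {u v} (p : SDPath N u v) e → edges-then p e (fromℕ (length p)) ≡ e
  edges-then-fromℕ []      e = refl
  edges-then-fromℕ (_ ∷ p) e = edges-then-fromℕ p e

  edges-then-injective : ∀ {u v} (p : SDPath N u v) e → Injective _≡_ _≡_ (edge p) →
                         (∀ i → edge p i ≢ e) → Injective _≡_ _≡_ (edges-then p e)
  edges-then-injective p e edge-inj e∉p = injective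
    where
    e-last : ∀ i → edges-then p e (inject₁ i) ≢ edges-then p e (fromℕ (length p))
    e-last i eq = e∉p i (trans (sym (edges-then-inject₁ p e i)) (trans eq (edges-then-fromℕ p e)))

    injective : Injective _≡_ _≡_ (edges-then p e)
    injective {i} {j} eq with view i | view j
    ... | ‵fromℕ     | ‵fromℕ     = refl
    ... | ‵fromℕ     | ‵inject₁ j = ⊥-elim (e-last j (sym eq))
    ... | ‵inject₁ i | ‵fromℕ     = ⊥-elim (e-last i eq)
    ... | ‵inject₁ i | ‵inject₁ j =
      cong inject₁ (edge-inj (trans (sym (edges-then-inject₁ p e i))
                                    (trans eq (edges-then-inject₁ p e j))))

  close-path : ∀ {a b e} (p : SDPath N b a) → Simple p → b ≢ a →
               SDStep N e a b → (∀ i → edge p i ≢ e) → SDCycle N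
  close-path []                 _      b≢a _       _   = ⊥-elim (b≢a refl)
  close-path {b = b} {e} p@(_ ∷ _) simple _   closing e∉p =
    SDCycle-from-steps (node p) (edges-then p e)
      (node-injective p simple) (edges-then-injective p e (edge-injective p simple) e∉p)
      (λ i → subst (λ e' → SDStep N e' (node p (inject₁ i)) (node p (suc i)))
                   (sym (edges-then-inject₁ p e i)) (step p i))
      (subst₂ (λ e' x → SDStep N e' x b) (sym (edges-then-fromℕ p e)) (sym (node-last p)) closing)

  Acyclic⇒¬child⇝parent : Acyclic N → ∀ j → ¬ SDPath N (proj₂ (D N j)) (proj₁ (D N j))
  Acyclic⇒¬child⇝parent acyclic j child⇝parent with loop-erase child⇝parent
  ... | p , simple = acyclic (close-path p simple (D-noloop N j ∘ sym) refl
                                         (closing-edge-not-on-path refl p simple))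

  FCycle⇒SDCycle : FCycle N → SDCycle N
  FCycle⇒SDCycle c = record
    { k = k ; nodes = nodes ; edges = inj₁ ∘ edges
    ; nodes-inj = nodes-inj ; edges-inj = edges-inj ∘ inj₁-injective
    ; steps = steps }
    where open FCycle c

  SDPath⇒UPath : Acyclic N → ∀ {u v} → SDPath N u v → SDPath N v u → UPath N u v
  SDPath⇒UPath acyclic []                    _ = []
  SDPath⇒UPath acyclic ((inj₁ i , J) ∷ p)    q =
    (i , J) ∷ SDPath⇒UPath acyclic p (q ++ ((inj₁ i , J) ∷ []))
  SDPath⇒UPath acyclic ((inj₂ j , refl) ∷ p) q = ⊥-elim (Acyclic⇒¬child⇝parent acyclic j (p ++ q))

  UPath⊎entered : ∀ {w u} → SDPath N w u →
                  UPath N w u ⊎ ∃ λ c → 1 ≤ indeg N c × UPath N c u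
  UPath⊎entered [] = inj₁ []
  UPath⊎entered ((inj₁ i , J) ∷ p) with UPath⊎entered p
  ... | inj₁ w~u     = inj₁ ((i , J) ∷ w~u)
  ... | inj₂ entered = inj₂ entered
  UPath⊎entered ((inj₂ j , refl) ∷ p) with UPath⊎entered p
  ... | inj₁ c~u     = inj₂ (_ , incoming⇒indeg>0 refl , c~u)
  ... | inj₂ entered = inj₂ entered

  InRootComponent⇒indeg≡0 : Acyclic N → ∀ {u} → InRootComponent N u →
                            ∀ w → ConnectedF N u w → indeg N w ≡ 0
  InRootComponent⇒indeg≡0 acyclic {u} root w u~w = n<1⇒n≡0 (≰⇒> not-entered)
    where
    w⇝u : SDPath N w u
    w⇝u = UPath⇒SDPath (UPath-reverse u~w)
    not-entered : ¬ 1 ≤ indeg N w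
    not-entered pos with indeg>0⇒incoming pos
    ... | j , refl = Acyclic⇒¬child⇝parent acyclic j
                       (w⇝u ++ root (proj₁ (D N j)) ((inj₂ j , refl) ∷ w⇝u))

  indeg≡0⇒InRootComponent : ∀ {u} → (∀ w → ConnectedF N u w → indeg N w ≡ 0) →
                            InRootComponent N u
  indeg≡0⇒InRootComponent unentered w w⇝u with UPath⊎entered w⇝u
  ... | inj₁ w~u = UPath⇒SDPath (UPath-reverse w~u)
  ... | inj₂ (c , pos , c~u) = ⊥-elim (<⇒≢ pos (sym (unentered c (UPath-reverse c~u))))

module _ (N : SDGraph) (o : Fin (mU N) → Bool) (same : SameHybridEdges N o) where

  private
    N' : SDGraph
    N' = fullyDirect N o

    child' : Fin (mU N + mD N) → Node N
    child' e = proj₂ (D N' e)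

  head : Fin (mU N) → Node N
  head i = proj₂ (orient N o i)

  private
    child'-↑ˡ : ∀ i → child' (i ↑ˡ mD N) ≡ head i
    child'-↑ˡ i = cong (λ z → proj₂ ([ orient N o , D N ]′ z)) (splitAt-↑ˡ (mU N) i (mD N))

    child'-↑ʳ : ∀ j → child' (mU N ↑ʳ j) ≡ proj₂ (D N j)
    child'-↑ʳ j = cong (λ z → proj₂ ([ orient N o , D N ]′ z)) (splitAt-↑ʳ (mU N) (mD N) j)

    ↑ˡ≢↑ʳ : ∀ i j → i ↑ˡ mD N ≢ mU N ↑ʳ j
    ↑ˡ≢↑ʳ i j eq with trans (sym (splitAt-↑ˡ (mU N) i (mD N)))
                            (trans (cong (splitAt (mU N)) eq) (splitAt-↑ʳ (mU N) (mD N) j))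
    ... | ()

  head-not-hybrid : ∀ i → ¬ HybridNode N' (head i)
  head-not-hybrid i hybrid
    with Equivalence.to (same (i ↑ˡ mD N)) (subst (HybridNode N') (sym (child'-↑ˡ i)) hybrid)
  ... | j , split≡inj₂ , _ with trans (sym (splitAt-↑ˡ (mU N) i (mD N))) split≡inj₂
  ... | ()

  head-not-entered : ∀ i {w} → head i ≡ w → ¬ 1 ≤ indeg N w
  head-not-entered i refl pos with indeg>0⇒incoming N pos
  ... | j , j↦head = head-not-hybrid i
    (two-incoming⇒hybrid N' (↑ˡ≢↑ʳ i j) (child'-↑ˡ i) (trans (child'-↑ʳ j) j↦head))

  head-injective : Injective _≡_ _≡_ head
  head-injective {i} {i'} same-head with i ≟ i'
  ... | yes i≡i' = i≡i'
  ... | no  i≢i' = ⊥-elim (head-not-hybrid i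
    (two-incoming⇒hybrid N' (i≢i' ∘ ↑ˡ-injective (mD N) i i')
                            (child'-↑ˡ i) (trans (child'-↑ˡ i') (sym same-head))))

  orient-Joins : ∀ {i x w} → Joins N i x w → orient N o i ≡ (x , w) ⊎ orient N o i ≡ (w , x)
  orient-Joins {i} J with o i | J
  ... | true  | inj₁ Uᵢ≡xw = inj₁ Uᵢ≡xw
  ... | true  | inj₂ Uᵢ≡wx = inj₂ Uᵢ≡wx
  ... | false | inj₁ refl  = inj₂ refl
  ... | false | inj₂ refl  = inj₁ refl

  data OrientedPath (y : Node N) : Node N → Set where
    []   : OrientedPath y y
    _∷ʳ_ : ∀ {w x} → OrientedPath y w → (Σ (Fin (mU N)) λ i → orient N o i ≡ (w , x)) →
           OrientedPath y x

  -- Each node is the head of at most one edge, so following an undirected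
  -- path towards a node that heads no edge, every edge must point back.
  UPath⇒OrientedPath : ∀ {x y} → (∀ i → head i ≢ y) → UPath N x y → OrientedPath y x
  UPath⇒OrientedPath y-unheaded [] = []
  UPath⇒OrientedPath y-unheaded ((i , J) ∷ p)
    with orient-Joins J | UPath⇒OrientedPath y-unheaded p
  ... | inj₂ w→x | q                = q ∷ʳ (i , w→x)
  ... | inj₁ x→w | []               = ⊥-elim (y-unheaded i (cong proj₂ x→w))
  ... | inj₁ x→w | q ∷ʳ (i' , x'→w)
    with head-injective (trans (cong proj₂ x→w) (sym (cong proj₂ x'→w)))
  ... | refl with trans (sym x→w) x'→w
  ... | refl = q

  entered-connected⇒equal : ∀ {u v} → ConnectedF N u v → 1 ≤ indeg N u → 1 ≤ indeg N v → u ≡ v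
  entered-connected⇒equal u~v u-entered v-entered
    with UPath⇒OrientedPath (λ i headᵢ≡v → head-not-entered i headᵢ≡v v-entered) u~v
  ... | []             = refl
  ... | _ ∷ʳ (i , w→u) = ⊥-elim (head-not-entered i (cong proj₂ w→u) u-entered)

proposition5 : (N : SDGraph) → Network N →
    ForestF N
    × (∀ u v → ConnectedF N u v ⇔ Equiv N u v)
    × (∀ j → ¬ Equiv N (proj₁ (D N j)) (proj₂ (D N j)))
    × (∀ u v → ConnectedF N u v → indeg N u ≥ 1 → indeg N v ≥ 1 → u ≡ v)
    × (∀ u → InRootComponent N u ⇔ (∀ w → ConnectedF N u w → indeg N w ≡ 0))
    × (∀ u → InRootComponent N u → ∀ w → ConnectedF N u w → TreeNode N w)
proposition5 N (acyclic , o , _ , same) =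
    acyclic ∘ FCycle⇒SDCycle N
  , (λ u v → mk⇔ (λ u~v → UPath⇒SDPath N (UPath-reverse N u~v) , UPath⇒SDPath N u~v)
                 (λ (v⇝u , u⇝v) → SDPath⇒UPath N acyclic u⇝v v⇝u))
  , (λ j (child⇝parent , _) → Acyclic⇒¬child⇝parent N acyclic j child⇝parent)
  , (λ u v → entered-connected⇒equal N o same)
  , (λ u → mk⇔ (InRootComponent⇒indeg≡0 N acyclic) (indeg≡0⇒InRootComponent N))
  , λ u root w u~w → subst (_≤ 1) (sym (InRootComponent⇒indeg≡0 N acyclic root w u~w)) z≤n
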